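{- Let $q$ be a prime power with $q-1=ml^2$ for integers $l,m\ge 2$. Let $\theta$ be a primitive element of $\mathbb{F}_q$, $\beta=\theta^l$, $C=\langle\beta^m\rangle$, and $A_j=\beta^jC$ for $0\le j\le m-1$. Let $Q=q^t$ with $t$ a positive integer, $M=(Q-1)/l^2$, let $\tilde\theta$ be a primitive element of $\mathbb{F}_Q$ with $\theta=\tilde\theta^{(Q-1)/(q-1)}=\tilde\theta^{M/m}$, and put $\tilde\beta=\tilde\theta^l$, $\tilde C=\langle\tilde\beta^M\rangle$, $\tilde A_k=\tilde\beta^k\tilde C$ for $0\le k\le M-1$. Assume $\gcd(l,t)=1$. Then for any non-empty subset $S\subseteq\{1,\dots,m-1\}$, the family $\{A_0,\dots,A_{m-1}\}$ is a $(q,m,l;|S|)$-$S$-CEDF in $(\mathbb{F}_q,+)$ if and only if the family $\{\tilde A_0,\dots,\tilde A_{M-1}\}$ is a $(Q,M,l;|S|)$-$\tilde S$-CEDF in $(\mathbb{F}_Q,+)$, where $\tilde S=\{\tfrac{M}{m}c:\ c\in S\}\subseteq\{1,\dots,M-1\}$.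
   Context: Let $(G,+)$ be a finite abelian group of order $n$ (written additively), let $l,m\ge 2$, and let $S$ be a non-empty subset of $\{1,\dots,m-1\}$. For non-empty subsets $A,B\subseteq G$, $\Delta(A,B)$ denotes the multiset $\{\{a-b: a\in A, b\in B\}\}$. A family $\{A_0,\dots,A_{m-1}\}$ of $m$ pairwise disjoint subsets of $G$ is an $(n,m,l;\lambda)$-$S$-circular external difference family (CEDF) in $G$ if $|A_i|=l$ for all $i$ and each nonzero $g\in G$ occurs exactly $\lambda$ times in the multiset union $\bigcup_{c\in S}\bigcup_{i=0}^{m-1}\Delta(A_{i+c},A_i)$, where subscripts are taken modulo $m$. Here $\mathbb{F}_q$ is regarded as a subfield of $\mathbb{F}_Q$. -}

module Defs where

open import Level using (0ℓ)
open import Data.Nat using (ℕ; zero; suc; _<_; _≤_; _%_)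
import Data.Nat as N
open import Data.Nat.Primality using (Prime)
open import Data.Fin using (Fin; toℕ)
open import Data.Fin.Properties using (any?)
open import Data.Product using (Σ; ∃; _×_; _,_; proj₁; proj₂)
open import Data.Empty using (⊥)
open import Data.List using (List; length; filter; cartesianProduct; map; upTo)
open import Data.Nat.ListAction using (sum)
open import Data.List.Relation.Unary.Any using (Any)
open import Data.List.Relation.Unary.AllPairs using (AllPairs)
open import Relation.Nullary using (¬_; Dec)
open import Relation.Nullary.Decidable using (_×-dec_)
open import Relation.Binary using (Decidable)
open import Relation.Binary.PropositionalEquality using (_≡_)
open import Algebra.Bundles using (CommutativeRing)
import Relation.Unary as U

IsPrimePower : ℕ → Set
IsPrimePower q = Σ ℕ λ p → Σ ℕ λ k → Prime p × q ≡ p Data.Nat.^ suc k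

-- a mod m, with the convention a mod 0 = a (only used with m ≥ 2)
modℕ : ℕ → ℕ → ℕ
modℕ a zero = a
modℕ a (suc k) = a % suc k

record FiniteField (n : ℕ) : Set₁ where
  field
    cring : CommutativeRing 0ℓ 0ℓ
  open CommutativeRing cring public
  field
    0≉1      : ¬ (0# ≈ 1#)
    inverse  : ∀ x → ¬ (x ≈ 0#) → ∃ λ y → x * y ≈ 1#
    _≟_      : Decidable _≈_
    elems    : List Carrier
    complete : ∀ x → Any (x ≈_) elems
    distinct : AllPairs (λ a b → ¬ (a ≈ b)) elems
    size     : length elems ≡ n

module FF {n : ℕ} (F : FiniteField n) where
  open FiniteField F

  infixr 8 _^_
  _^_ : Carrier → ℕ → Carrier
  x ^ zero = 1#
  x ^ suc k = x * (x ^ k)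

  Primitive : Carrier → Set
  Primitive θ = ∀ x → ¬ (x ≈ 0#) → ∃ λ k → x ≈ θ ^ k

  -- membership in the coset z⟨y⟩ = { z * y^k }, where the cyclic group ⟨y⟩
  -- generated by y is { y^k : k < n } (n = |F|, enough exponents)
  InCoset : Carrier → Carrier → Carrier → Set
  InCoset z y x = Σ (Fin n) λ k → x ≈ z * (y ^ toℕ k)

  inCoset? : ∀ z y → U.Decidable (InCoset z y)
  inCoset? z y x = any? (λ k → x ≟ (z * (y ^ toℕ k)))

  card : {P : Carrier → Set} → U.Decidable P → ℕ
  card P? = length (filter P? elems)

  multΔ : {A B : Carrier → Set} → U.Decidable A → U.Decidable B → Carrier → ℕ
  multΔ A? B? g =
    length (filter (λ p → A? (proj₁ p) ×-dec (B? (proj₂ p) ×-dec ((proj₁ p - proj₂ p) ≟ g)))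
                   (cartesianProduct elems elems))

  -- {A_0,…,A_{m-1}} (A_i given for all i, only i < m used) is an
  -- (n,m,l;λ)-S-CEDF in (F,+); S is given as a duplicate-free list.
  record IsCEDF (m l λ' : ℕ) (S : List ℕ)
                (A : ℕ → Carrier → Set) (A? : ∀ i → U.Decidable (A i)) : Set where
    field
      disjoint : ∀ i j → i < m → j < m → ¬ (i ≡ j) → ∀ x → A i x → A j x → ⊥
      sizes    : ∀ i → i < m → card (A? i) ≡ l
      diffs    : ∀ g → ¬ (g ≈ 0#) →
                 sum (map (λ c → sum (map (λ i → multΔ (A? (modℕ (i N.+ c) m)) (A? i) g) (upTo m))) S)
                   ≡ λ'

{-# OPTIONS --safe #-}
-- Every nonzero element is a power of the primitive element θ, and A_j consists of the θ ^ (l J)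
-- with J ≡ j (mod m). A pair (a, b) ∈ A_{i+c} × A_i with a - b = g is determined by its quotient
-- x = a / b, which runs over A_c, since b is then forced to be g / (x - 1); and this b is an l-th
-- power exactly when log (x - 1) ≡ log g (mod l). So the CEDF condition says that for every
-- residue ρ modulo l, the number of pairs (c, x) ∈ S × A_c with log (x - 1) ≡ ρ (mod l) is |S|.
-- The embedding of F_q into F_Q multiplies discrete logarithms by e = (Q - 1) / (q - 1) and maps
-- A_c onto Ã_{ec}. As e ≡ t (mod l) is invertible modulo l, the residue counts of F_Q are those
-- of F_q with ρ replaced by e ρ, and the two conditions are equivalent.

module Submission where

open import Level using (Level; 0ℓ; _⊔_)
open import Function using (_∘_)
open import Function.Bundles using (_⇔_; mk⇔)
open import Function.Construct.Composition using (_⇔-∘_)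
open import Function.Construct.Symmetry using (⇔-sym)
open import Data.Empty using (⊥)
open import Data.Nat
  using (ℕ; zero; suc; _+_; _*_; _∸_; _≤_; _<_; z≤n; s≤s; s≤s⁻¹; NonZero; >-nonZero; >-nonZero⁻¹; _%_; _/_)
import Data.Nat as ℕ
import Data.Nat.Properties as ℕₚ
open import Data.Nat.DivMod
open import Data.Nat.Divisibility using (_∣_; divides; m%n≡0⇒n∣m; n∣m*n)
open import Data.Nat.GCD using (gcd; gcd-GCD; GCD; module Bézout)
open import Data.Nat.ListAction using (sum)
open import Data.Nat.Tactic.RingSolver using (solve-∀)
open import Data.Fin using (toℕ; fromℕ<)
open import Data.Fin.Properties using (toℕ-fromℕ<)
open import Data.List using (List; []; _∷_; _++_; length; map; filter; cartesianProduct; upTo)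
open import Data.List.Properties
  using (length-map; length-removeAt′; length-++; length-upTo; filter-++; filter-≐; map-∘; map-cong-local)
open import Data.List.Relation.Unary.Any using (here; there; _─_)
open import Data.List.Relation.Unary.All as All using (All; []; _∷_)
import Data.List.Relation.Unary.All.Properties as All
open import Data.List.Relation.Unary.AllPairs using ([]; _∷_)
open import Data.List.Relation.Unary.Unique.Setoid using () renaming (Unique to Uniqueₛ)
open import Data.List.Relation.Unary.Unique.Propositional using (Unique)
import Data.List.Relation.Unary.Unique.Setoid.Properties as Uniqueₛ
import Data.List.Relation.Unary.Unique.Propositional.Properties as UniqueProp
import Data.List.Membership.Setoid as SetoidMembership
import Data.List.Membership.Setoid.Properties as Mem
import Data.List.Membership.Propositional.Properties as PropMem
open import Data.Product using (∃; ∃₂; Σ; _×_; _,_; proj₁; proj₂)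
open import Data.Product.Relation.Binary.Pointwise.NonDependent using (_×ₛ_)
open import Relation.Nullary using (¬_; Dec; yes; no; contradiction)
open import Relation.Nullary.Decidable using (_×-dec_)
open import Relation.Unary using (Pred; Decidable; U; _∩_)
open import Relation.Unary.Properties using (∁?)
open import Relation.Binary using (Setoid) renaming (Decidable to Decidable₂)
open import Relation.Binary.Definitions using (_Respects_; tri<; tri≈; tri>)
open import Relation.Binary.PropositionalEquality as ≡ using (_≡_)
import Relation.Binary.Reasoning.Setoid as SetoidReasoning
open import Algebra.Bundles using (CommutativeRing)
open import Algebra.Morphism.Structures using (module RingMorphisms)
import Algebra.Properties.Ring as RingProperties
import Algebra.Properties.Semiring.Exp as ExpProperties
open import Defs

private
  variable
    c₁ c₂ p₁ p₂ ℓ₁ ℓ₂ : Level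

-- Arithmetic modulo d

module _ (d : ℕ) .{{_ : NonZero d}} where
  open ≡.≡-Reasoning

  %-+-cong : ∀ {a b c e} → a % d ≡ b % d → c % d ≡ e % d → (a + c) % d ≡ (b + e) % d
  %-+-cong {a} {b} {c} {e} a≡b c≡e = begin
    (a + c) % d           ≡⟨ %-distribˡ-+ a c d ⟩
    (a % d + c % d) % d   ≡⟨ ≡.cong₂ (λ x y → (x + y) % d) a≡b c≡e ⟩
    (b % d + e % d) % d   ≡⟨ %-distribˡ-+ b e d ⟨
    (b + e) % d           ∎

  %-*-cong : ∀ {a b c e} → a % d ≡ b % d → c % d ≡ e % d → (a * c) % d ≡ (b * e) % d
  %-*-cong {a} {b} {c} {e} a≡b c≡e = begin
    (a * c) % d           ≡⟨ %-distribˡ-* a c d ⟩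
    (a % d * (c % d)) % d ≡⟨ ≡.cong₂ (λ x y → (x * y) % d) a≡b c≡e ⟩
    (b % d * (e % d)) % d ≡⟨ %-distribˡ-* b e d ⟨
    (b * e) % d           ∎

  %-+-cancelʳ : ∀ a b c → (a + c) % d ≡ (b + c) % d → a % d ≡ b % d
  %-+-cancelʳ a b c eq = begin
    a % d               ≡⟨ %-remove-+ʳ a d∣c+c′ ⟨
    (a + (c + c′)) % d  ≡⟨ ≡.cong (_% d) (ℕₚ.+-assoc a c c′) ⟨
    (a + c + c′) % d    ≡⟨ %-+-cong eq ≡.refl ⟩
    (b + c + c′) % d    ≡⟨ ≡.cong (_% d) (ℕₚ.+-assoc b c c′) ⟩
    (b + (c + c′)) % d  ≡⟨ %-remove-+ʳ b d∣c+c′ ⟩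
    b % d               ∎
    where
    c′ : ℕ
    c′ = c * (d ∸ 1)
    d∣c+c′ : d ∣ c + c′
    d∣c+c′ = divides c (begin
      c + c * (d ∸ 1)   ≡⟨ ℕₚ.*-suc c (d ∸ 1) ⟨
      c * suc (d ∸ 1)   ≡⟨ ≡.cong (c *_) (ℕₚ.m+[n∸m]≡n (>-nonZero⁻¹ d)) ⟩
      c * d             ∎)

  %-*-cancelˡ : ∀ {e s} a b → (e * s) % d ≡ 1 % d → (e * a) % d ≡ (e * b) % d → a % d ≡ b % d
  %-*-cancelˡ {e} {s} a b es≡1 ea≡eb = begin
    a % d              ≡⟨ ≡.cong (_% d) (ℕₚ.*-identityˡ a) ⟨
    (1 * a) % d        ≡⟨ %-*-cong se≡1 ≡.refl ⟨
    (s * e * a) % d    ≡⟨ ≡.cong (_% d) (ℕₚ.*-assoc s e a) ⟩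
    (s * (e * a)) % d  ≡⟨ %-*-cong {s} ≡.refl ea≡eb ⟩
    (s * (e * b)) % d  ≡⟨ ≡.cong (_% d) (ℕₚ.*-assoc s e b) ⟨
    (s * e * b) % d    ≡⟨ %-*-cong se≡1 ≡.refl ⟩
    (1 * b) % d        ≡⟨ ≡.cong (_% d) (ℕₚ.*-identityˡ b) ⟩
    b % d              ∎
    where
    se≡1 : (s * e) % d ≡ 1 % d
    se≡1 = ≡.trans (≡.cong (_% d) (ℕₚ.*-comm s e)) es≡1

  unit⇒1≤ : ∀ {e s} → 2 ≤ d → (e * s) % d ≡ 1 % d → 1 ≤ e
  unit⇒1≤ {zero}  2≤d 0≡1 =
    contradiction (≡.trans (≡.sym (m<n⇒m%n≡m (>-nonZero⁻¹ d))) (≡.trans 0≡1 (m<n⇒m%n≡m 2≤d))) ℕₚ.0≢1+n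
  unit⇒1≤ {suc _} _   _   = s≤s z≤n

  coprime⇒inverse : ∀ t → gcd d t ≡ 1 → Σ ℕ λ s → (t * s) % d ≡ 1 % d
  coprime⇒inverse t gcd≡1 with Bézout.identity (≡.subst (GCD d t) gcd≡1 (gcd-GCD d t))
  ... | Bézout.-+ x y eq = y , (begin
    (t * y) % d       ≡⟨ ≡.cong (_% d) (≡.trans (ℕₚ.*-comm t y) (≡.sym eq)) ⟩
    (1 + x * d) % d   ≡⟨ [m+kn]%n≡m%n 1 x d ⟩
    1 % d             ∎)
  ... | Bézout.+- x y eq = y * k , %-+-cancelʳ (t * (y * k)) 1 k (begin
    (t * (y * k) + k) % d  ≡⟨ ≡.cong (_% d) (rearrange t y k) ⟩
    ((1 + y * t) * k) % d  ≡⟨ ≡.cong (λ z → (z * k) % d) eq ⟩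
    (x * d * k) % d        ≡⟨ ≡.cong (_% d) (rearrange′ x d k) ⟩
    (x * k * d) % d        ≡⟨ m*n%n≡0 (x * k) d ⟩
    0                      ≡⟨ n%n≡0 d ⟨
    d % d                  ≡⟨ ≡.cong (_% d) (ℕₚ.m+[n∸m]≡n (>-nonZero⁻¹ d)) ⟨
    (1 + k) % d            ∎)
    where
    k : ℕ
    k = d ∸ 1
    rearrange : ∀ t y k → t * (y * k) + k ≡ (1 + y * t) * k
    rearrange = solve-∀
    rearrange′ : ∀ x d k → x * d * k ≡ x * k * d
    rearrange′ = solve-∀

modℕ≡% : ∀ a d .{{_ : NonZero d}} → modℕ a d ≡ a % d
modℕ≡% a (suc d) = ≡.refl

geometric : ℕ → ℕ → ℕ
geometric q zero    = 0
geometric q (suc t) = 1 + q * geometric q t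

geometric-* : ∀ p t → geometric (suc p) t * p + 1 ≡ suc p ℕ.^ t
geometric-* p zero    = ≡.refl
geometric-* p (suc t) = ≡.trans (rearrange p (geometric (suc p) t)) (≡.cong (suc p *_) (geometric-* p t))
  where
  rearrange : ∀ p G → (1 + (1 + p) * G) * p + 1 ≡ (1 + p) * (G * p + 1)
  rearrange = solve-∀

geometric-% : ∀ {q} d .{{_ : NonZero d}} → q % d ≡ 1 % d → ∀ t → geometric q t % d ≡ t % d
geometric-% d q≡1 zero    = ≡.refl
geometric-% d q≡1 (suc t) =
  %-+-cong d {1} ≡.refl (≡.trans (%-*-cong d q≡1 (geometric-% d q≡1 t)) (≡.cong (_% d) (ℕₚ.*-identityˡ t)))

-- e = (q ^ t - 1) / (q - 1) = 1 + q + ⋯ + q ^ (t - 1), and q ≡ 1 modulo every divisor of q - 1.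
quotient≡degree : ∀ {q t e} d .{{_ : NonZero d}} → 0 < q ∸ 1 → d ∣ q ∸ 1 →
                  q ℕ.^ t ∸ 1 ≡ e * (q ∸ 1) → e % d ≡ t % d
quotient≡degree {suc p} {t} {e} d 0<p (divides k p≡kd) q^t-1≡ep = begin
  e % d                    ≡⟨ ≡.cong (_% d) e≡geometric ⟩
  geometric (suc p) t % d  ≡⟨ geometric-% d (≡.trans (≡.cong (λ x → suc x % d) p≡kd) ([m+kn]%n≡m%n 1 k d)) t ⟩
  t % d                    ∎
  where
  open ≡.≡-Reasoning
  e≡geometric : e ≡ geometric (suc p) t
  e≡geometric = ℕₚ.*-cancelʳ-≡ e _ p {{>-nonZero 0<p}} (≡.trans (≡.sym q^t-1≡ep)
    (≡.trans (≡.cong (_∸ 1) (≡.sym (geometric-* p t))) (ℕₚ.m+n∸n≡m _ 1)))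

index-invertible : ∀ {q t e} d .{{_ : NonZero d}} → 0 < q ∸ 1 → d ∣ q ∸ 1 → gcd d t ≡ 1 →
                   q ℕ.^ t ∸ 1 ≡ e * (q ∸ 1) → Σ ℕ λ s → (e * s) % d ≡ 1 % d
index-invertible {q} {t} {e} d 0<q-1 d∣q-1 gcd≡1 q^t-1≡e[q-1] = s , ≡.trans (%-*-cong d e≡t ≡.refl) ts≡1
  where
  e≡t : e % d ≡ t % d
  e≡t = quotient≡degree {q} {t} {e} d 0<q-1 d∣q-1 q^t-1≡e[q-1]
  s : ℕ
  s = proj₁ (coprime⇒inverse d t gcd≡1)
  ts≡1 : (t * s) % d ≡ 1 % d
  ts≡1 = proj₂ (coprime⇒inverse d t gcd≡1)

extension-index-invertible : ∀ {q m l t M e} .{{_ : NonZero l}} → 1 ≤ m → q ∸ 1 ≡ m * (l * l) → gcd l t ≡ 1 →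
                             q ℕ.^ t ∸ 1 ≡ M * (l * l) → M ≡ e * m → Σ ℕ λ s → (e * s) % l ≡ 1 % l
extension-index-invertible {q} {m} {l} {t} {M} {e} 1≤m q-1≡ml² gcd≡1 Q-1≡Ml² M≡em =
  index-invertible {q} {t} {e} l 0<q-1 l∣q-1 gcd≡1 Q-1≡e[q-1]
  where
  0<q-1 : 0 < q ∸ 1
  0<q-1 = ≡.subst (0 <_) (≡.sym q-1≡ml²) (>-nonZero⁻¹ _ {{ℕₚ.m*n≢0 m (l * l) {{>-nonZero 1≤m}} {{ℕₚ.m*n≢0 l l}}}})
  l∣q-1 : l ∣ q ∸ 1
  l∣q-1 = divides (m * l) (≡.trans q-1≡ml² (≡.sym (ℕₚ.*-assoc m l l)))
  Q-1≡e[q-1] : q ℕ.^ t ∸ 1 ≡ e * (q ∸ 1)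
  Q-1≡e[q-1] = ≡.trans Q-1≡Ml² (≡.trans (≡.cong (_* (l * l)) M≡em)
                 (≡.trans (ℕₚ.*-assoc e m (l * l)) (≡.cong (e *_) (≡.sym q-1≡ml²))))

scaled-bounds : ∀ {e m M S} → 1 ≤ e → M ≡ e * m → All (λ c → 1 ≤ c × c < m) S → All (λ c → 1 ≤ c × c < M) (map (e *_) S)
scaled-bounds {e} 1≤e M≡em = All.map⁺ ∘ All.map λ (1≤c , c<m) →
  ℕₚ.*-mono-≤ 1≤e 1≤c , ≡.subst (e * _ <_) (≡.sym M≡em) (ℕₚ.*-monoʳ-< e {{>-nonZero 1≤e}} c<m)

-- Counting up to a setoid equality

module _ {A : Set c₁} {P : Pred A p₁} (P? : Decidable P) where

  length-filter-∁ : ∀ xs → length (filter P? xs) + length (filter (∁? P?) xs) ≡ length xs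
  length-filter-∁ []       = ≡.refl
  length-filter-∁ (x ∷ xs) with P? x
  ... | yes _ = ≡.cong suc (length-filter-∁ xs)
  ... | no  _ = ≡.trans (ℕₚ.+-suc _ _) (≡.cong suc (length-filter-∁ xs))

module _ {A : Set c₁} {B : Set c₂} {R : Pred (A × B) p₁} (R? : Decidable R) where

  length-filter-cartesianProduct : ∀ xs ys →
    length (filter R? (cartesianProduct xs ys)) ≡ sum (map (λ x → length (filter (λ y → R? (x , y)) ys)) xs)
  length-filter-cartesianProduct []       ys = ≡.refl
  length-filter-cartesianProduct (x ∷ xs) ys = begin
    length (filter R? (map (x ,_) ys ++ cartesianProduct xs ys))
      ≡⟨ ≡.cong length (filter-++ R? (map (x ,_) ys) _) ⟩
    length (filter R? (map (x ,_) ys) ++ filter R? (cartesianProduct xs ys))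
      ≡⟨ length-++ (filter R? (map (x ,_) ys)) ⟩
    length (filter R? (map (x ,_) ys)) + length (filter R? (cartesianProduct xs ys))
      ≡⟨ ≡.cong₂ _+_ (length-filter-map ys) (length-filter-cartesianProduct xs ys) ⟩
    length (filter (λ y → R? (x , y)) ys) + sum (map (λ x → length (filter (λ y → R? (x , y)) ys)) xs) ∎
    where
    open ≡.≡-Reasoning
    length-filter-map : ∀ zs → length (filter R? (map (x ,_) zs)) ≡ length (filter (λ y → R? (x , y)) zs)
    length-filter-map []       = ≡.refl
    length-filter-map (z ∷ zs) with R? (x , z)
    ... | yes _ = ≡.cong suc (length-filter-map zs)
    ... | no  _ = length-filter-map zs

module _ (S : Setoid c₁ ℓ₁) where
  open Setoid S
  open SetoidMembership S using (_∈_)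

  ∈-─ : ∀ {x y ys} (x∈ys : x ∈ ys) → y ∈ ys → ¬ y ≈ x → y ∈ (ys ─ x∈ys)
  ∈-─ (here x≈z) (here y≈z) y≉x = contradiction (trans y≈z (sym x≈z)) y≉x
  ∈-─ (here _)   (there y∈) _   = y∈
  ∈-─ (there _)  (here y≈z) _   = here y≈z
  ∈-─ (there x∈) (there y∈) y≉x = there (∈-─ x∈ y∈ y≉x)

  unique⇒length≤ : ∀ {xs ys} → Uniqueₛ S xs → All (_∈ ys) xs → length xs ≤ length ys
  unique⇒length≤ [] [] = z≤n
  unique⇒length≤ {ys = ys} (x∉xs ∷ xs!) (x∈ys ∷ xs⊆ys) = ℕₚ.≤-trans
    (s≤s (unique⇒length≤ xs! (All.zipWith (λ (y∈ys , x≉y) → ∈-─ x∈ys y∈ys (x≉y ∘ sym)) (xs⊆ys , x∉xs))))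
    (ℕₚ.≤-reflexive (≡.sym (length-removeAt′ ys _)))

  pigeonhole : Decidable₂ _≈_ → ∀ (f : ℕ → Carrier) K {ys} → (∀ {k} → k ≤ K → f k ∈ ys) → length ys ≤ K →
               ∃₂ λ i j → i < j × j ≤ K × f i ≈ f j
  pigeonhole _≟_ f zero {[]} f∈ys _ with () ← f∈ys z≤n
  pigeonhole _≟_ f (suc K) {ys} f∈ys |ys|≤1+K with ℕₚ.anyUpTo? (λ i → f i ≟ f (suc K)) (suc K)
  ... | yes (i , i<1+K , fi≈fK) = i , suc K , i<1+K , ℕₚ.≤-refl , fi≈fK
  ... | no no-collision-with-fK =
    let i , j , i<j , j≤K , fi≈fj = pigeonhole _≟_ f K f∈ys─fK |ys─fK|≤K
    in  i , j , i<j , ℕₚ.m≤n⇒m≤1+n j≤K , fi≈fj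
    where
    fK∈ys : f (suc K) ∈ ys
    fK∈ys = f∈ys ℕₚ.≤-refl
    f∈ys─fK : ∀ {k} → k ≤ K → f k ∈ (ys ─ fK∈ys)
    f∈ys─fK {k} k≤K =
      ∈-─ fK∈ys (f∈ys (ℕₚ.m≤n⇒m≤1+n k≤K)) (λ fk≈fK → no-collision-with-fK (k , s≤s k≤K , fk≈fK))
    |ys─fK|≤K : length (ys ─ fK∈ys) ≤ K
    |ys─fK|≤K = s≤s⁻¹ (ℕₚ.≤-trans (ℕₚ.≤-reflexive (≡.sym (length-removeAt′ ys _))) |ys|≤1+K)

  record Enumerates (P : Pred Carrier p₁) (xs : List Carrier) : Set (c₁ ⊔ ℓ₁ ⊔ p₁) where
    field
      unique   : Uniqueₛ S xs
      sound    : ∀ {x} → x ∈ xs → P x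
      complete : ∀ {x} → P x → x ∈ xs

  filter⁺ : ∀ {P : Pred Carrier p₁} {Q : Pred Carrier p₂} {xs} (Q? : Decidable Q) → Q Respects _≈_ →
            Enumerates P xs → Enumerates (P ∩ Q) (filter Q? xs)
  filter⁺ Q? Q-resp e = record
    { unique   = Uniqueₛ.filter⁺ S Q? unique
    ; sound    = λ x∈ → let x∈xs , Qx = Mem.∈-filter⁻ S Q? Q-resp x∈ in sound x∈xs , Qx
    ; complete = λ (Px , Qx) → Mem.∈-filter⁺ S Q? Q-resp (complete Px) Qx
    }
    where open Enumerates e

module _ (S : Setoid c₁ ℓ₁) (T : Setoid c₂ ℓ₂) where
  private
    module S = Setoid S
    module T = Setoid T

  cartesianProduct⁺ : ∀ {P : Pred S.Carrier p₁} {Q : Pred T.Carrier p₂} {xs ys} →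
    Enumerates S P xs → Enumerates T Q ys → Enumerates (S ×ₛ T) (λ (x , y) → P x × Q y) (cartesianProduct xs ys)
  cartesianProduct⁺ eS eT = record
    { unique   = Uniqueₛ.cartesianProduct⁺ S T (Enumerates.unique eS) (Enumerates.unique eT)
    ; sound    = λ xy∈ → let x∈ , y∈ = Mem.∈-cartesianProduct⁻ S T _ _ xy∈
                         in Enumerates.sound eS x∈ , Enumerates.sound eT y∈
    ; complete = λ (Px , Qy) → Mem.∈-cartesianProduct⁺ S T (Enumerates.complete eS Px) (Enumerates.complete eT Qy)
    }

  record Correspondence (P : Pred S.Carrier p₁) (Q : Pred T.Carrier p₂) : Set (c₁ ⊔ c₂ ⊔ ℓ₁ ⊔ ℓ₂ ⊔ p₁ ⊔ p₂) where
    field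
      to        : S.Carrier → T.Carrier
      from      : T.Carrier → S.Carrier
      to-cong   : ∀ {x y} → x S.≈ y → to x T.≈ to y
      from-cong : ∀ {x y} → x T.≈ y → from x S.≈ from y
      to-∈      : ∀ {x} → P x → Q (to x)
      from-∈    : ∀ {y} → Q y → P (from y)
      from∘to   : ∀ {x} → P x → from (to x) S.≈ x
      to∘from   : ∀ {y} → Q y → to (from y) T.≈ y

module _ {S : Setoid c₁ ℓ₁} {T : Setoid c₂ ℓ₂} where
  private
    module S = Setoid S
    module T = Setoid T

  length≤-injection : ∀ {P : Pred S.Carrier p₁} {Q : Pred T.Carrier p₂} {xs ys} (f : S.Carrier → T.Carrier) →
    (∀ {x} → P x → Q (f x)) → (∀ {x y} → P x → P y → f x T.≈ f y → x S.≈ y) →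
    Enumerates S P xs → Enumerates T Q ys → length xs ≤ length ys
  length≤-injection {P = P} {xs = xs} f f-∈ f-inj eS eT = ℕₚ.≤-trans
    (ℕₚ.≤-reflexive (≡.sym (length-map f xs)))
    (unique⇒length≤ T (unique-map Pxs (Enumerates.unique eS)) (All.map⁺ (All.map (Enumerates.complete eT ∘ f-∈) Pxs)))
    where
    Pxs : All P xs
    Pxs = All.tabulateₛ S (Enumerates.sound eS)
    unique-map : ∀ {zs} → All P zs → Uniqueₛ S zs → Uniqueₛ T (map f zs)
    unique-map [] [] = []
    unique-map (Px ∷ Pzs) (x∉ ∷ zs!) =
      All.map⁺ (All.zipWith (λ (Py , x≉y) fx≈fy → x≉y (f-inj Px Py fx≈fy)) (Pzs , x∉)) ∷ unique-map Pzs zs!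

module _ {S : Setoid c₁ ℓ₁} {T : Setoid c₂ ℓ₂} where
  private
    module S = Setoid S
    module T = Setoid T

  length-correspondence : ∀ {P : Pred S.Carrier p₁} {Q : Pred T.Carrier p₂} {xs ys} →
    Correspondence S T P Q → Enumerates S P xs → Enumerates T Q ys → length xs ≡ length ys
  length-correspondence c eS eT = ℕₚ.≤-antisym
    (length≤-injection to to-∈ (λ Px Py e → S.trans (S.sym (from∘to Px)) (S.trans (from-cong e) (from∘to Py))) eS eT)
    (length≤-injection from from-∈ (λ Qx Qy e → T.trans (T.sym (to∘from Qx)) (T.trans (to-cong e) (to∘from Qy))) eT eS)
    where open Correspondence c

upTo-enumerates : ∀ k → Enumerates (≡.setoid ℕ) (_< k) (upTo k)
upTo-enumerates k = record { unique = UniqueProp.upTo⁺ k ; sound = PropMem.∈-upTo⁻ ; complete = PropMem.∈-upTo⁺ }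

-- Finite fields and discrete logarithms

module FiniteFieldProperties {n : ℕ} (F : FiniteField n) where
  open FiniteField F hiding (_+_) renaming (_*_ to _·_)
  open FF F using (_^_)
  open RingProperties ring public using (x∙y⁻¹≈ε⇒x≈y; x[y-z]≈xy-xz; [y-z]x≈yx-zx)
  private
    module Exp = ExpProperties semiring
    module ≈-Reasoning = SetoidReasoning setoid

  inv : Carrier → Carrier
  inv x with x ≟ 0#
  ... | yes _   = 0#
  ... | no x≉0 = proj₁ (inverse x x≉0)

  inverseʳ : ∀ {x} → x ≉ 0# → x · inv x ≈ 1#
  inverseʳ {x} x≉0 with x ≟ 0#
  ... | yes x≈0  = contradiction x≈0 x≉0
  ... | no x≉0′ = proj₂ (inverse x x≉0′)

  inverseˡ : ∀ {x} → x ≉ 0# → inv x · x ≈ 1#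
  inverseˡ {x} x≉0 = trans (*-comm (inv x) x) (inverseʳ x≉0)

  x⁻¹·[x·y]≈y : ∀ {x} y → x ≉ 0# → inv x · (x · y) ≈ y
  x⁻¹·[x·y]≈y {x} y x≉0 = begin
    inv x · (x · y) ≈⟨ *-assoc (inv x) x y ⟨
    inv x · x · y   ≈⟨ *-congʳ (inverseˡ x≉0) ⟩
    1# · y          ≈⟨ *-identityˡ y ⟩
    y               ∎
    where open ≈-Reasoning

  x·y⁻¹·y≈x : ∀ x {y} → y ≉ 0# → x · inv y · y ≈ x
  x·y⁻¹·y≈x x {y} y≉0 = begin
    x · inv y · y   ≈⟨ *-assoc x (inv y) y ⟩
    x · (inv y · y) ≈⟨ *-congˡ (inverseˡ y≉0) ⟩
    x · 1#          ≈⟨ *-identityʳ x ⟩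
    x               ∎
    where open ≈-Reasoning

  x·y·y⁻¹≈x : ∀ x {y} → y ≉ 0# → x · y · inv y ≈ x
  x·y·y⁻¹≈x x {y} y≉0 = begin
    x · y · inv y   ≈⟨ *-assoc x y (inv y) ⟩
    x · (y · inv y) ≈⟨ *-congˡ (inverseʳ y≉0) ⟩
    x · 1#          ≈⟨ *-identityʳ x ⟩
    x               ∎
    where open ≈-Reasoning

  y·[x·y⁻¹]≈x : ∀ x {y} → y ≉ 0# → y · (x · inv y) ≈ x
  y·[x·y⁻¹]≈x x {y} y≉0 = trans (*-comm y (x · inv y)) (x·y⁻¹·y≈x x y≉0)

  *-cancelˡ : ∀ {x y z} → x ≉ 0# → x · y ≈ x · z → y ≈ z
  *-cancelˡ {x} {y} {z} x≉0 xy≈xz = begin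
    y               ≈⟨ x⁻¹·[x·y]≈y y x≉0 ⟨
    inv x · (x · y) ≈⟨ *-congˡ xy≈xz ⟩
    inv x · (x · z) ≈⟨ x⁻¹·[x·y]≈y z x≉0 ⟩
    z               ∎
    where open ≈-Reasoning

  *-≉0 : ∀ {x y} → x ≉ 0# → y ≉ 0# → x · y ≉ 0#
  *-≉0 {x} x≉0 y≉0 xy≈0 = y≉0 (*-cancelˡ x≉0 (trans xy≈0 (sym (zeroʳ x))))

  inv-≉0 : ∀ {x} → x ≉ 0# → inv x ≉ 0#
  inv-≉0 {x} x≉0 x⁻¹≈0 = 0≉1 (trans (sym (zeroʳ x)) (trans (*-congˡ (sym x⁻¹≈0)) (inverseʳ x≉0)))

  inv-cong : ∀ {x y} → x ≈ y → inv x ≈ inv y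
  inv-cong {x} {y} x≈y with x ≟ 0# | y ≟ 0#
  ... | yes _    | yes _    = refl
  ... | yes x≈0  | no y≉0  = contradiction (trans (sym x≈y) x≈0) y≉0
  ... | no x≉0  | yes y≈0  = contradiction (trans x≈y y≈0) x≉0
  ... | no x≉0  | no y≉0  =
    *-cancelˡ x≉0 (trans (proj₂ (inverse x x≉0)) (sym (trans (*-congʳ x≈y) (proj₂ (inverse y y≉0)))))

  ^≡Exp^ : ∀ x k → x ^ k ≡ x Exp.^ k
  ^≡Exp^ x zero    = ≡.refl
  ^≡Exp^ x (suc k) = ≡.cong (x ·_) (^≡Exp^ x k)

  ^-homo-* : ∀ x i j → x ^ (i + j) ≈ x ^ i · x ^ j
  ^-homo-* x i j rewrite ^≡Exp^ x (i + j) | ^≡Exp^ x i | ^≡Exp^ x j = Exp.^-homo-* x i j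

  ^-assocʳ : ∀ x i j → (x ^ i) ^ j ≈ x ^ (i * j)
  ^-assocʳ x i j rewrite ^≡Exp^ (x ^ i) j | ^≡Exp^ x i | ^≡Exp^ x (i * j) = Exp.^-assocʳ x i j

  ^-congˡ : ∀ k {x y} → x ≈ y → x ^ k ≈ y ^ k
  ^-congˡ k {x} {y} x≈y rewrite ^≡Exp^ x k | ^≡Exp^ y k = Exp.^-congˡ k x≈y

  ^-≉0 : ∀ {x} k → x ≉ 0# → x ^ k ≉ 0#
  ^-≉0 zero    _   1≈0 = 0≉1 (sym 1≈0)
  ^-≉0 (suc k) x≉0     = *-≉0 x≉0 (^-≉0 k x≉0)

  1^ : ∀ k → 1# ^ k ≈ 1#
  1^ zero    = refl
  1^ (suc k) = trans (*-identityˡ _) (1^ k)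

  ^-% : ∀ {x} d .{{_ : NonZero d}} → x ^ d ≈ 1# → ∀ k → x ^ k ≈ x ^ (k % d)
  ^-% {x} d x^d≈1 k = begin
    x ^ k                            ≡⟨ ≡.cong (x ^_) k≡r+dq ⟩
    x ^ (k % d + d * (k / d))        ≈⟨ ^-homo-* x (k % d) _ ⟩
    x ^ (k % d) · x ^ (d * (k / d))  ≈⟨ *-congˡ (^-assocʳ x d (k / d)) ⟨
    x ^ (k % d) · (x ^ d) ^ (k / d)  ≈⟨ *-congˡ (^-congˡ (k / d) x^d≈1) ⟩
    x ^ (k % d) · 1# ^ (k / d)       ≈⟨ *-congˡ (1^ (k / d)) ⟩
    x ^ (k % d) · 1#                 ≈⟨ *-identityʳ _ ⟩
    x ^ (k % d)                      ∎
    where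
    open ≈-Reasoning
    k≡r+dq : k ≡ k % d + d * (k / d)
    k≡r+dq = ≡.trans (m≡m%n+[m/n]*n k d) (≡.cong (k % d +_) (ℕₚ.*-comm (k / d) d))

  elems-enumerates : Enumerates setoid U elems
  elems-enumerates = record { unique = distinct ; sound = _ ; complete = λ {x} _ → complete x }

  enumerate : ∀ {P : Pred Carrier 0ℓ} (P? : Decidable P) → P Respects _≈_ → Enumerates setoid P (filter P? elems)
  enumerate {P} P? P-resp = record
    { unique   = Enumerates.unique e
    ; sound    = proj₂ ∘ Enumerates.sound e
    ; complete = λ Px → Enumerates.complete e (_ , Px)
    }
    where
    e : Enumerates setoid (U ∩ P) (filter P? elems)
    e = filter⁺ setoid P? P-resp elems-enumerates

  nonzeros : List Carrier
  nonzeros = filter (∁? (_≟ 0#)) elems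

  nonzeros-enumerates : Enumerates setoid (_≉ 0#) nonzeros
  nonzeros-enumerates = enumerate (∁? (_≟ 0#)) (λ x≈y x≉0 y≈0 → x≉0 (trans x≈y y≈0))

  length-nonzeros : length nonzeros ≡ n ∸ 1
  length-nonzeros = ≡.cong (_∸ 1) (≡.trans (≡.cong (_+ length nonzeros) (≡.sym length-zeros))
                                           (≡.trans (length-filter-∁ (_≟ 0#) elems) size))
    where
    zeros : List Carrier
    zeros = filter (_≟ 0#) elems
    identity : Correspondence setoid setoid (_≈ 0#) (_≈ 0#)
    identity = record { to = λ x → x ; from = λ x → x ; to-cong = λ e → e ; from-cong = λ e → e
                      ; to-∈ = λ e → e ; from-∈ = λ e → e ; from∘to = λ _ → refl ; to∘from = λ _ → refl }
    length-zeros : length zeros ≡ 1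
    length-zeros = length-correspondence identity
      (enumerate (_≟ 0#) (λ x≈y x≈0 → trans (sym x≈y) x≈0))
      (record { unique = [] ∷ [] ; sound = λ { (here x≈0) → x≈0 } ; complete = here })

module DiscreteLog {n : ℕ} (F : FiniteField n) (θ : FiniteField.Carrier F)
                   (θ-primitive : FF.Primitive F θ) (2≤N : 2 ≤ n ∸ 1) where
  open FiniteField F hiding (_+_) renaming (_*_ to _·_)
  open FF F using (_^_)
  open FiniteFieldProperties F
  open SetoidMembership setoid using (_∈_)
  private module ≈-Reasoning = SetoidReasoning setoid

  N : ℕ
  N = n ∸ 1

  instance
    N-nonZero : NonZero N
    N-nonZero = >-nonZero (ℕₚ.<-trans (s≤s z≤n) 2≤N)

  powers-cover⇒N≤ : ∀ d → (∀ {x} → x ≉ 0# → ∃ λ k → k < d × x ≈ θ ^ k) → N ≤ d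
  powers-cover⇒N≤ d cover = begin
    N                             ≡⟨ length-nonzeros ⟨
    length nonzeros               ≤⟨ unique⇒length≤ setoid (Enumerates.unique nonzeros-enumerates)
                                       (All.tabulateₛ setoid (∈-powers ∘ Enumerates.sound nonzeros-enumerates)) ⟩
    length (map (θ ^_) (upTo d))  ≡⟨ ≡.trans (length-map _ (upTo d)) (length-upTo d) ⟩
    d                             ∎
    where
    open ℕₚ.≤-Reasoning
    ∈-powers : ∀ {x} → x ≉ 0# → x ∈ map (θ ^_) (upTo d)
    ∈-powers x≉0 = let k , k<d , x≈θ^k = cover x≉0 in
      Mem.∈-resp-≈ setoid (sym x≈θ^k) (Mem.∈-map⁺ (≡.setoid ℕ) setoid (λ { ≡.refl → refl }) (PropMem.∈-upTo⁺ k<d))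

  θ≉0 : θ ≉ 0#
  θ≉0 θ≈0 = ℕₚ.<⇒≱ 2≤N (powers-cover⇒N≤ 1 only-θ^0)
    where
    only-θ^0 : ∀ {x} → x ≉ 0# → ∃ λ k → k < 1 × x ≈ θ ^ k
    only-θ^0 {x} x≉0 with θ-primitive x x≉0
    ... | zero  , x≈1     = 0 , s≤s z≤n , x≈1
    ... | suc k , x≈θθ^k = contradiction (trans x≈θθ^k (trans (*-congʳ θ≈0) (zeroˡ _))) x≉0

  θ^≉0 : ∀ k → θ ^ k ≉ 0#
  θ^≉0 k = ^-≉0 k θ≉0

  period⇒N≤ : ∀ d .{{_ : NonZero d}} → θ ^ d ≈ 1# → N ≤ d
  period⇒N≤ d θ^d≈1 = powers-cover⇒N≤ d λ {x} x≉0 →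
    let k , x≈θ^k = θ-primitive x x≉0 in k % d , m%n<n k d , trans x≈θ^k (^-% d θ^d≈1 k)

  θ^i≈θ^j⇒θ^[j∸i]≈1 : ∀ {i j} → i ≤ j → θ ^ i ≈ θ ^ j → θ ^ (j ∸ i) ≈ 1#
  θ^i≈θ^j⇒θ^[j∸i]≈1 {i} {j} i≤j θ^i≈θ^j = sym (*-cancelˡ (θ^≉0 i) (begin
    θ ^ i · 1#            ≈⟨ *-identityʳ _ ⟩
    θ ^ i                 ≈⟨ θ^i≈θ^j ⟩
    θ ^ j                 ≡⟨ ≡.cong (θ ^_) (ℕₚ.m+[n∸m]≡n i≤j) ⟨
    θ ^ (i + (j ∸ i))     ≈⟨ ^-homo-* θ i (j ∸ i) ⟩
    θ ^ i · θ ^ (j ∸ i)   ∎))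
    where open ≈-Reasoning

  -- the N + 1 powers θ ^ 0, …, θ ^ N cannot all differ, and no period is shorter than N
  θ^N≈1 : θ ^ N ≈ 1#
  θ^N≈1 with pigeonhole setoid _≟_ (θ ^_) N (λ {k} _ → Enumerates.complete nonzeros-enumerates (θ^≉0 k))
                          (ℕₚ.≤-reflexive length-nonzeros)
  ... | i , j , i<j , j≤N , θ^i≈θ^j = ≡.subst (λ d → θ ^ d ≈ 1#) j∸i≡N θ^[j∸i]≈1
    where
    θ^[j∸i]≈1 : θ ^ (j ∸ i) ≈ 1#
    θ^[j∸i]≈1 = θ^i≈θ^j⇒θ^[j∸i]≈1 (ℕₚ.<⇒≤ i<j) θ^i≈θ^j
    instance
      j∸i-nonZero : NonZero (j ∸ i)
      j∸i-nonZero = >-nonZero (ℕₚ.m<n⇒0<n∸m i<j)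
    j∸i≡N : j ∸ i ≡ N
    j∸i≡N = ℕₚ.≤-antisym (ℕₚ.≤-trans (ℕₚ.m∸n≤m j i) j≤N) (period⇒N≤ (j ∸ i) θ^[j∸i]≈1)

  ^-%N : ∀ k → θ ^ k ≈ θ ^ (k % N)
  ^-%N = ^-% N θ^N≈1

  ^-injective-< : ∀ {i j} → i < j → j < N → θ ^ i ≉ θ ^ j
  ^-injective-< {i} {j} i<j j<N θ^i≈θ^j =
    ℕₚ.<⇒≱ (ℕₚ.≤-<-trans (ℕₚ.m∸n≤m j i) j<N) (period⇒N≤ (j ∸ i) (θ^i≈θ^j⇒θ^[j∸i]≈1 (ℕₚ.<⇒≤ i<j) θ^i≈θ^j))
    where
    instance
      j∸i-nonZero : NonZero (j ∸ i)
      j∸i-nonZero = >-nonZero (ℕₚ.m<n⇒0<n∸m i<j)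

  ^-injective : ∀ {i j} → i < N → j < N → θ ^ i ≈ θ ^ j → i ≡ j
  ^-injective {i} {j} i<N j<N θ^i≈θ^j with ℕₚ.<-cmp i j
  ... | tri≈ _ i≡j _ = i≡j
  ... | tri< i<j _ _ = contradiction θ^i≈θ^j (^-injective-< i<j j<N)
  ... | tri> _ _ j<i = contradiction (sym θ^i≈θ^j) (^-injective-< j<i i<N)

  ^≈^⇒%≡ : ∀ {i j} → θ ^ i ≈ θ ^ j → i % N ≡ j % N
  ^≈^⇒%≡ {i} {j} θ^i≈θ^j = ^-injective (m%n<n i N) (m%n<n j N) (trans (sym (^-%N i)) (trans θ^i≈θ^j (^-%N j)))

  log : Carrier → ℕ
  log x with x ≟ 0#
  ... | yes _   = 0
  ... | no x≉0 = proj₁ (θ-primitive x x≉0) % N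

  log<N : ∀ x → log x < N
  log<N x with x ≟ 0#
  ... | yes _ = >-nonZero⁻¹ N
  ... | no _  = m%n<n _ N

  log-spec : ∀ {x} → x ≉ 0# → x ≈ θ ^ log x
  log-spec {x} x≉0 with x ≟ 0#
  ... | yes x≈0  = contradiction x≈0 x≉0
  ... | no x≉0′ = trans (proj₂ (θ-primitive x x≉0′)) (^-%N _)

  log-unique : ∀ {x k} → x ≈ θ ^ k → log x ≡ k % N
  log-unique {x} {k} x≈θ^k = ≡.trans (≡.sym (m<n⇒m%n≡m (log<N x))) (^≈^⇒%≡ (trans (sym (log-spec x≉0)) x≈θ^k))
    where
    x≉0 : x ≉ 0#
    x≉0 x≈0 = θ^≉0 k (trans (sym x≈θ^k) x≈0)

  log-θ^ : ∀ k → log (θ ^ k) ≡ k % N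
  log-θ^ k = log-unique refl

  log-0 : ∀ {x} → x ≈ 0# → log x ≡ 0
  log-0 {x} x≈0 with x ≟ 0#
  ... | yes _    = ≡.refl
  ... | no x≉0  = contradiction x≈0 x≉0

  log-cong : ∀ {x y} → x ≈ y → log x ≡ log y
  log-cong {x} {y} x≈y = by-cases (y ≟ 0#)
    where
    by-cases : Dec (y ≈ 0#) → log x ≡ log y
    by-cases (yes y≈0) = ≡.trans (log-0 (trans x≈y y≈0)) (≡.sym (log-0 y≈0))
    by-cases (no y≉0)  = ≡.trans (log-unique (trans x≈y (log-spec y≉0))) (m<n⇒m%n≡m (log<N y))

  log-· : ∀ {x y} → x ≉ 0# → y ≉ 0# → log (x · y) ≡ (log x + log y) % N
  log-· {x} {y} x≉0 y≉0 = log-unique (trans (*-cong (log-spec x≉0) (log-spec y≉0)) (sym (^-homo-* θ (log x) (log y))))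

-- The cosets A_j

module Cosets {n : ℕ} (F : FiniteField n) (θ : FiniteField.Carrier F) (θ-primitive : FF.Primitive F θ)
              (m l : ℕ) (N≡ml² : n ∸ 1 ≡ m * (l * l)) (2≤m : 2 ≤ m) .{{_ : NonZero l}} where
  open FiniteField F hiding (_+_) renaming (_*_ to _·_)
  open FF F using (_^_; InCoset; inCoset?; card; multΔ; IsCEDF)
  open FiniteFieldProperties F
  private module ≈-Reasoning = SetoidReasoning setoid

  instance
    m-nonZero : NonZero m
    m-nonZero = >-nonZero (ℕₚ.<-trans (s≤s z≤n) 2≤m)

  2≤N : 2 ≤ n ∸ 1
  2≤N = ≡.subst (2 ≤_) (≡.sym N≡ml²) (ℕₚ.≤-trans 2≤m (ℕₚ.m≤m*n m (l * l) {{ℕₚ.m*n≢0 l l}}))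

  open DiscreteLog F θ θ-primitive 2≤N public

  K : ℕ
  K = l * m

  N≡K*l : N ≡ K * l
  N≡K*l = ≡.trans N≡ml² (rearrange m l)
    where
    rearrange : ∀ m l → m * (l * l) ≡ l * m * l
    rearrange = solve-∀

  l∣N : l ∣ N
  l∣N = divides K N≡K*l

  instance
    K-nonZero : NonZero K
    K-nonZero = ℕₚ.m*n≢0 l m

  l*J%N : ∀ J → (l * J) % N ≡ l * (J % K)
  l*J%N J = begin
    (l * J) % N       ≡⟨ ≡.cong (_% N) (ℕₚ.*-comm l J) ⟩
    (J * l) % N       ≡⟨ %-congʳ N≡K*l ⟩
    (J * l) % (K * l) ≡⟨ m%n*o≡m*o%[n*o] J K l ⟨
    J % K * l         ≡⟨ ℕₚ.*-comm (J % K) l ⟩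
    l * (J % K)       ∎
    where
    open ≡.≡-Reasoning
    instance
      Kl-nonZero : NonZero (K * l)
      Kl-nonZero = ℕₚ.m*n≢0 K l

  l≤N : l ≤ N
  l≤N = ≡.subst (l ≤_) (≡.sym N≡ml²) (ℕₚ.≤-trans (ℕₚ.m≤m*n l l) (ℕₚ.m≤n*m (l * l) m))

  A : ℕ → Carrier → Set
  A j = InCoset ((θ ^ l) ^ j) ((θ ^ l) ^ m)

  A? : ∀ j → Decidable (A j)
  A? j = inCoset? ((θ ^ l) ^ j) ((θ ^ l) ^ m)

  InClass : ℕ → Carrier → Set
  InClass j x = ∃ λ J → J % m ≡ j × x ≈ θ ^ (l * J)

  element : ℕ → ℕ → Carrier
  element j u = θ ^ (l * (j + u * m))

  -- A nonzero l-th power x is θ ^ (l * index x) with index x < K = l m, and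
  -- index x = j + slot x * m places it in A_j at position slot x < l.
  index : Carrier → ℕ
  index x = log x / l

  slot : Carrier → ℕ
  slot x = index x / m

  residue : Carrier → ℕ
  residue x = log x % l

  log-θ^l* : ∀ J → log (θ ^ (l * J)) ≡ l * (J % K)
  log-θ^l* J = ≡.trans (log-θ^ (l * J)) (l*J%N J)

  index-θ^l* : ∀ J → index (θ ^ (l * J)) ≡ J % K
  index-θ^l* J = ≡.trans (≡.cong (_/ l) (≡.trans (log-θ^l* J) (ℕₚ.*-comm l (J % K)))) (m*n/n≡m (J % K) l)

  index<K : ∀ x → index x < K
  index<K x = m<n*o⇒m/o<n (≡.subst (log x <_) N≡K*l (log<N x))

  slot<l : ∀ x → slot x < l
  slot<l x = m<n*o⇒m/o<n (index<K x)

  index-cong : ∀ {x y} → x ≈ y → index x ≡ index y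
  index-cong = ≡.cong (_/ l) ∘ log-cong

  slot-cong : ∀ {x y} → x ≈ y → slot x ≡ slot y
  slot-cong = ≡.cong (_/ m) ∘ index-cong

  inClass-cong : ∀ {j x y} → x ≈ y → InClass j x → InClass j y
  inClass-cong x≈y (J , J%m≡j , x≈θ^lJ) = J , J%m≡j , trans (sym x≈y) x≈θ^lJ

  inClass-≉0 : ∀ {j x} → InClass j x → x ≉ 0#
  inClass-≉0 (J , _ , x≈θ^lJ) x≈0 = θ^≉0 (l * J) (trans (sym x≈θ^lJ) x≈0)

  inClass⇒index%m : ∀ {j x} → InClass j x → index x % m ≡ j
  inClass⇒index%m {j} {x} (J , J%m≡j , x≈θ^lJ) = begin
    index x % m            ≡⟨ ≡.cong (_% m) (≡.trans (index-cong x≈θ^lJ) (index-θ^l* J)) ⟩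
    J % K % m              ≡⟨ m∣n⇒o%n%m≡o%m m K J (n∣m*n l) ⟩
    J % m                  ≡⟨ J%m≡j ⟩
    j                      ∎
    where open ≡.≡-Reasoning

  inClass-unique : ∀ {i j x} → InClass i x → InClass j x → i ≡ j
  inClass-unique x∈i x∈j = ≡.trans (≡.sym (inClass⇒index%m x∈i)) (inClass⇒index%m x∈j)

  inClass⇒log : ∀ {j x} → InClass j x → log x ≡ l * (j + slot x * m)
  inClass⇒log {j} {x} x∈j@(J , _ , x≈θ^lJ) = begin
    log x                         ≡⟨ ≡.trans (log-cong x≈θ^lJ) (log-θ^l* J) ⟩
    l * (J % K)                   ≡⟨ ≡.cong (l *_) (≡.trans (index-cong x≈θ^lJ) (index-θ^l* J)) ⟨
    l * index x                   ≡⟨ ≡.cong (l *_) (m≡m%n+[m/n]*n (index x) m) ⟩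
    l * (index x % m + slot x * m) ≡⟨ ≡.cong (λ i → l * (i + slot x * m)) (inClass⇒index%m x∈j) ⟩
    l * (j + slot x * m)          ∎
    where open ≡.≡-Reasoning

  inClass⇒≈element : ∀ {j x} → InClass j x → x ≈ element j (slot x)
  inClass⇒≈element x∈j = trans (log-spec (inClass-≉0 x∈j)) (reflexive (≡.cong (θ ^_) (inClass⇒log x∈j)))

  residue-cong : ∀ {x y} → x ≈ y → residue x ≡ residue y
  residue-cong = ≡.cong (_% l) ∘ log-cong

  inClass-· : ∀ {i j x y} → InClass i x → InClass j y → InClass ((i + j) % m) (x · y)
  inClass-· {i} {j} {x} {y} (I , I%m≡i , x≈θ^lI) (J , J%m≡j , y≈θ^lJ) = I + J , I+J%m≡i+j , (begin
    x · y                    ≈⟨ *-cong x≈θ^lI y≈θ^lJ ⟩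
    θ ^ (l * I) · θ ^ (l * J) ≈⟨ ^-homo-* θ (l * I) (l * J) ⟨
    θ ^ (l * I + l * J)      ≡⟨ ≡.cong (θ ^_) (ℕₚ.*-distribˡ-+ l I J) ⟨
    θ ^ (l * (I + J))        ∎)
    where
    open ≈-Reasoning
    I+J%m≡i+j : (I + J) % m ≡ (i + j) % m
    I+J%m≡i+j = ≡.trans (%-distribˡ-+ I J m) (≡.cong₂ (λ a b → (a + b) % m) I%m≡i J%m≡j)

  residue-· : ∀ {x y} → x ≉ 0# → y ≉ 0# → residue (x · y) ≡ (residue x + residue y) % l
  residue-· {x} {y} x≉0 y≉0 = begin
    log (x · y) % l               ≡⟨ ≡.cong (_% l) (log-· x≉0 y≉0) ⟩
    (log x + log y) % N % l       ≡⟨ m∣n⇒o%n%m≡o%m l N _ l∣N ⟩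
    (log x + log y) % l           ≡⟨ %-distribˡ-+ (log x) (log y) l ⟩
    (residue x + residue y) % l   ∎
    where open ≡.≡-Reasoning

  inClass⇒residue≡0 : ∀ {j x} → InClass j x → residue x ≡ 0
  inClass⇒residue≡0 {j} {x} x∈j =
    ≡.trans (≡.cong (_% l) (≡.trans (inClass⇒log x∈j) (ℕₚ.*-comm l _))) (m*n%n≡0 (j + slot x * m) l)

  residue≡0⇒inClass : ∀ {x} → x ≉ 0# → residue x ≡ 0 → InClass (index x % m) x
  residue≡0⇒inClass {x} x≉0 residue≡0 = index x , ≡.refl , (begin
    x                    ≈⟨ log-spec x≉0 ⟩
    θ ^ log x            ≡⟨ ≡.cong (θ ^_) (m*[n/m]≡n (m%n≡0⇒n∣m (log x) l residue≡0)) ⟨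
    θ ^ (l * index x)    ∎)
    where open ≈-Reasoning

  β-form : ∀ j k → (θ ^ l) ^ j · ((θ ^ l) ^ m) ^ k ≈ θ ^ (l * (j + k * m))
  β-form j k = begin
    (θ ^ l) ^ j · ((θ ^ l) ^ m) ^ k   ≈⟨ *-cong (^-assocʳ θ l j) (trans (^-assocʳ (θ ^ l) m k) (^-assocʳ θ l (m * k))) ⟩
    θ ^ (l * j) · θ ^ (l * (m * k))   ≈⟨ ^-homo-* θ (l * j) _ ⟨
    θ ^ (l * j + l * (m * k))         ≡⟨ ≡.cong (θ ^_) (rearrange l j m k) ⟩
    θ ^ (l * (j + k * m))             ∎
    where
    open ≈-Reasoning
    rearrange : ∀ l j m k → l * j + l * (m * k) ≡ l * (j + k * m)
    rearrange = solve-∀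

  inClass-element : ∀ {j} → j < m → ∀ u → InClass j (element j u)
  inClass-element {j} j<m u = j + u * m , ≡.trans ([m+kn]%n≡m%n j u m) (m<n⇒m%n≡m j<m) , refl

  A⇒inClass : ∀ {j x} → j < m → A j x → InClass j x
  A⇒inClass {j} j<m (k , x≈) = inClass-cong (sym (trans x≈ (β-form j (toℕ k)))) (inClass-element j<m (toℕ k))

  inClass⇒A : ∀ {j x} → InClass j x → A j x
  inClass⇒A {j} {x} x∈j = fromℕ< slot<n , (begin
    x                                                  ≈⟨ log-spec (inClass-≉0 x∈j) ⟩
    θ ^ log x                                          ≡⟨ ≡.cong (θ ^_) (inClass⇒log x∈j) ⟩
    θ ^ (l * (j + slot x * m))                         ≡⟨ ≡.cong (λ u → θ ^ (l * (j + u * m))) (toℕ-fromℕ< slot<n) ⟨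
    θ ^ (l * (j + toℕ (fromℕ< slot<n) * m))           ≈⟨ β-form j (toℕ (fromℕ< slot<n)) ⟨
    (θ ^ l) ^ j · ((θ ^ l) ^ m) ^ toℕ (fromℕ< slot<n) ∎)
    where
    open ≈-Reasoning
    slot<n : slot x < n
    slot<n = ℕₚ.<-≤-trans (slot<l x) (ℕₚ.≤-trans l≤N (ℕₚ.m∸n≤m n 1))

  A-resp : ∀ j → A j Respects _≈_
  A-resp _ x≈y (k , x≈) = k , trans (sym x≈y) x≈

  A-disjoint : ∀ i j → i < m → j < m → ¬ i ≡ j → ∀ x → A i x → A j x → ⊥
  A-disjoint i j i<m j<m i≢j x x∈Aᵢ x∈Aⱼ = i≢j (inClass-unique (A⇒inClass i<m x∈Aᵢ) (A⇒inClass j<m x∈Aⱼ))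

  slot-element : ∀ {j u} → j < m → u < l → slot (element j u) ≡ u
  slot-element {j} {u} j<m u<l = begin
    index (θ ^ (l * (j + u * m))) / m  ≡⟨ ≡.cong (_/ m) (≡.trans (index-θ^l* _) (m<n⇒m%n≡m j+u*m<K)) ⟩
    (j + u * m) / m                    ≡⟨ +-distrib-/-∣ʳ j {d = m} (n∣m*n u) ⟩
    j / m + u * m / m                  ≡⟨ ≡.cong₂ _+_ (m<n⇒m/n≡0 j<m) (m*n/n≡m u m) ⟩
    u                                  ∎
    where
    open ≡.≡-Reasoning
    j+u*m<K : j + u * m < K
    j+u*m<K = ℕₚ.<-≤-trans (ℕₚ.+-monoˡ-< (u * m) j<m) (ℕₚ.*-monoˡ-≤ m u<l)

  card-A : ∀ {j} → j < m → card (A? j) ≡ l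
  card-A {j} j<m = ≡.trans
    (length-correspondence slot-correspondence (enumerate (A? j) (A-resp j)) (upTo-enumerates l))
    (length-upTo l)
    where
    slot-correspondence : Correspondence setoid (≡.setoid ℕ) (A j) (_< l)
    slot-correspondence = record
      { to        = slot
      ; from      = element j
      ; to-cong   = slot-cong
      ; from-cong = λ { ≡.refl → refl }
      ; to-∈      = λ {x} _ → slot<l x
      ; from-∈    = λ {u} _ → inClass⇒A (inClass-element j<m u)
      ; from∘to   = λ x∈A → sym (inClass⇒≈element (A⇒inClass j<m x∈A))
      ; to∘from   = slot-element j<m
      }

  residue<l : ∀ x → residue x < l
  residue<l x = m%n<n (log x) l

  residue-·-inClass : ∀ {j z b} → z ≉ 0# → InClass j b → residue (z · b) ≡ residue z
  residue-·-inClass {j} {z} {b} z≉0 b∈j = begin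
    residue (z · b)              ≡⟨ residue-· z≉0 (inClass-≉0 b∈j) ⟩
    (residue z + residue b) % l  ≡⟨ ≡.cong (λ r → (residue z + r) % l) (inClass⇒residue≡0 b∈j) ⟩
    (residue z + 0) % l          ≡⟨ ≡.cong (_% l) (ℕₚ.+-identityʳ (residue z)) ⟩
    residue z % l                ≡⟨ m<n⇒m%n≡m (residue<l z) ⟩
    residue z                    ∎
    where open ≡.≡-Reasoning

  residue-·-cancelʳ : ∀ {x y} → x ≉ 0# → y ≉ 0# → residue (x · y) ≡ residue y → residue x ≡ 0
  residue-·-cancelʳ {x} {y} x≉0 y≉0 eq = begin
    residue x        ≡⟨ m<n⇒m%n≡m (residue<l x) ⟨
    residue x % l    ≡⟨ %-+-cancelʳ l (residue x) 0 (residue y) (begin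
        (residue x + residue y) % l  ≡⟨ residue-· x≉0 y≉0 ⟨
        residue (x · y)              ≡⟨ eq ⟩
        residue y                    ≡⟨ m<n⇒m%n≡m (residue<l y) ⟨
        residue y % l                ∎) ⟩
    0 % l            ≡⟨ m<n⇒m%n≡m (ℕ.>-nonZero⁻¹ l) ⟩
    0                ∎
    where open ≡.≡-Reasoning

  inClass-quotient : ∀ {i k z b} → k < m → InClass i b → InClass ((i + k) % m) (z · b) → InClass k z
  inClass-quotient {i} {k} {z} {b} k<m b∈i zb∈i+k = ≡.subst (λ j → InClass j z) class≡k z∈class
    where
    z≉0 : z ≉ 0#
    z≉0 z≈0 = inClass-≉0 zb∈i+k (trans (*-congʳ z≈0) (zeroˡ b))
    z∈class : InClass (index z % m) z
    z∈class = residue≡0⇒inClass z≉0 (≡.trans (≡.sym (residue-·-inClass z≉0 b∈i)) (inClass⇒residue≡0 zb∈i+k))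
    class≡k : index z % m ≡ k
    class≡k = begin
      index z % m          ≡⟨ m%n%n≡m%n (index z) m ⟨
      index z % m % m      ≡⟨ %-+-cancelʳ m (index z % m) k i (begin
          (index z % m + i) % m  ≡⟨ inClass-unique (inClass-· z∈class b∈i) zb∈i+k ⟩
          (i + k) % m            ≡⟨ ≡.cong (_% m) (ℕₚ.+-comm i k) ⟩
          (k + i) % m            ∎) ⟩
      k % m                ≡⟨ m<n⇒m%n≡m k<m ⟩
      k                    ∎
      where open ≡.≡-Reasoning

  count : ℕ → ℕ → ℕ
  count c ρ = length (filter (λ u → residue (element c u - 1#) ℕ.≟ ρ) (upTo l))

  element-1≉0 : ∀ {c} → 1 ≤ c → c < m → ∀ u → element c u - 1# ≉ 0#
  element-1≉0 {c} 1≤c c<m u x-1≈0 = ℕₚ.<⇒≢ 1≤c (≡.sym (inClass-unique (inClass-element c<m u) x∈0))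
    where
    x∈0 : InClass 0 (element c u)
    x∈0 = 0 , m<n⇒m%n≡m (ℕ.>-nonZero⁻¹ m) ,
          trans (x∙y⁻¹≈ε⇒x≈y _ 1# x-1≈0) (reflexive (≡.cong (θ ^_) (≡.sym (ℕₚ.*-zeroʳ l))))

  module Difference {c g} (1≤c : 1 ≤ c) (c<m : c < m) (g≉0 : g ≉ 0#) where
    private
      x : ℕ → Carrier
      x = element c
      y : ℕ → Carrier
      y u = x u - 1#
      y≉0 : ∀ u → y u ≉ 0#
      y≉0 = element-1≉0 1≤c c<m

    Triple : Set
    Triple = ℕ × Carrier × Carrier

    Δ : Triple → Set
    Δ (i , a , b) = A (modℕ (i + c) m) a × A i b × a - b ≈ g

    Δ? : Decidable Δ
    Δ? (i , a , b) = A? (modℕ (i + c) m) a ×-dec (A? i b ×-dec ((a - b) ≟ g))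

    Solution : ℕ → Set
    Solution u = residue (y u) ≡ residue g

    solutionTriple : ℕ → Triple
    solutionTriple u = index b % m , b · x u , b
      where
      b : Carrier
      b = g · inv (y u)

    TripleSetoid : Setoid 0ℓ 0ℓ
    TripleSetoid = ≡.setoid ℕ ×ₛ (setoid ×ₛ setoid)

    open Setoid TripleSetoid using () renaming (_≈_ to _≋_)

    module OfTriple {i a b} (i<m : i < m) (a∈A : A (modℕ (i + c) m) a) (b∈A : A i b) (a-b≈g : a - b ≈ g) where

      b∈i : InClass i b
      b∈i = A⇒inClass i<m b∈A

      b≉0 : b ≉ 0#
      b≉0 = inClass-≉0 b∈i

      quotient∈c : InClass c (a · inv b)
      quotient∈c = inClass-quotient c<m b∈i (inClass-cong (sym (x·y⁻¹·y≈x a b≉0)) a∈i+c)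
        where
        a∈i+c : InClass ((i + c) % m) a
        a∈i+c = A⇒inClass (m%n<n (i + c) m) (≡.subst (λ j → A j a) (modℕ≡% (i + c) m) a∈A)

      u₀ : ℕ
      u₀ = slot (a · inv b)

      x≈quotient : x u₀ ≈ a · inv b
      x≈quotient = sym (inClass⇒≈element quotient∈c)

      y·b≈g : y u₀ · b ≈ g
      y·b≈g = begin
        (x u₀ - 1#) · b            ≈⟨ *-congʳ (+-congʳ x≈quotient) ⟩
        (a · inv b - 1#) · b       ≈⟨ [y-z]x≈yx-zx b (a · inv b) 1# ⟩
        a · inv b · b - 1# · b     ≈⟨ +-cong (x·y⁻¹·y≈x a b≉0) (-‿cong (*-identityˡ b)) ⟩
        a - b                      ≈⟨ a-b≈g ⟩
        g                          ∎
        where open ≈-Reasoning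

      solution : Solution u₀
      solution = ≡.trans (≡.sym (residue-·-inClass (y≉0 u₀) b∈i)) (residue-cong y·b≈g)

      solutionTriple-u₀ : solutionTriple u₀ ≋ (i , a , b)
      solutionTriple-u₀ = ≡.trans (≡.cong (_% m) (index-cong b′≈b)) (inClass⇒index%m b∈i) , b′·x≈a , b′≈b
        where
        b′ : Carrier
        b′ = g · inv (y u₀)
        b′≈b : b′ ≈ b
        b′≈b = sym (*-cancelˡ (y≉0 u₀) (trans y·b≈g (sym (y·[x·y⁻¹]≈x g (y≉0 u₀)))))
        b′·x≈a : b′ · x u₀ ≈ a
        b′·x≈a = trans (*-cong b′≈b x≈quotient) (y·[x·y⁻¹]≈x a b≉0)

    module OfSolution {u} (sol : Solution u) where
      private
        b : Carrier
        b = g · inv (y u)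

      b·y≈g : b · y u ≈ g
      b·y≈g = x·y⁻¹·y≈x g (y≉0 u)

      b≉0 : b ≉ 0#
      b≉0 = *-≉0 g≉0 (inv-≉0 (y≉0 u))

      b∈class : InClass (index b % m) b
      b∈class = residue≡0⇒inClass b≉0 (residue-·-cancelʳ b≉0 (y≉0 u) (≡.trans (residue-cong b·y≈g) (≡.sym sol)))

      slot-quotient : u < l → slot (b · x u · inv b) ≡ u
      slot-quotient u<l =
        ≡.trans (slot-cong (trans (*-congʳ (*-comm b (x u))) (x·y·y⁻¹≈x (x u) b≉0))) (slot-element {c} {u} c<m u<l)

      Δ-solutionTriple : Δ (solutionTriple u)
      Δ-solutionTriple =
        ≡.subst (λ j → A j (b · x u)) (≡.sym (modℕ≡% _ m)) (inClass⇒A (inClass-· b∈class (inClass-element c<m u))) ,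
        inClass⇒A b∈class ,
        (begin
          b · x u - b         ≈⟨ +-congˡ (-‿cong (*-identityʳ b)) ⟨
          b · x u - b · 1#    ≈⟨ x[y-z]≈xy-xz b (x u) 1# ⟨
          b · y u             ≈⟨ b·y≈g ⟩
          g                   ∎)
        where open ≈-Reasoning

    Δ-resp : Δ Respects _≋_
    Δ-resp {i , _} (≡.refl , a≈a′ , b≈b′) (a∈A , b∈A , a-b≈g) =
      A-resp (modℕ (i + c) m) a≈a′ a∈A , A-resp i b≈b′ b∈A , trans (sym (+-cong a≈a′ (-‿cong b≈b′))) a-b≈g

    quotient-correspondence : Correspondence TripleSetoid (≡.setoid ℕ)
      ((λ (i , ab) → i < m × (U (proj₁ ab) × U (proj₂ ab))) ∩ Δ) ((_< l) ∩ Solution)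
    quotient-correspondence = record
      { to        = λ (_ , a , b) → slot (a · inv b)
      ; from      = solutionTriple
      ; to-cong   = λ (_ , a≈a′ , b≈b′) → slot-cong (*-cong a≈a′ (inv-cong b≈b′))
      ; from-cong = λ { ≡.refl → Setoid.refl TripleSetoid }
      ; to-∈      = λ ((i<m , _) , a∈A , b∈A , a-b≈g) → slot<l _ , OfTriple.solution i<m a∈A b∈A a-b≈g
      ; from-∈    = λ {u} (_ , sol) → (m%n<n _ m , _) , OfSolution.Δ-solutionTriple {u} sol
      ; from∘to   = λ ((i<m , _) , a∈A , b∈A , a-b≈g) → OfTriple.solutionTriple-u₀ i<m a∈A b∈A a-b≈g
      ; to∘from   = λ {u} (u<l , sol) → OfSolution.slot-quotient {u} sol u<l
      }

    Δ-sum : sum (map (λ i → multΔ (A? (modℕ (i + c) m)) (A? i) g) (upTo m)) ≡ count c (residue g)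
    Δ-sum = ≡.trans (≡.sym (length-filter-cartesianProduct Δ? (upTo m) _))
      (length-correspondence quotient-correspondence
        (filter⁺ TripleSetoid Δ? Δ-resp
          (cartesianProduct⁺ _ _ (upTo-enumerates m) (cartesianProduct⁺ setoid setoid elems-enumerates elems-enumerates)))
        (filter⁺ (≡.setoid ℕ) (λ u → residue (y u) ℕ.≟ residue g) (λ { ≡.refl s → s }) (upTo-enumerates l)))

  residue-θ^ : ∀ {ρ} → ρ < l → residue (θ ^ ρ) ≡ ρ
  residue-θ^ {ρ} ρ<l = begin
    log (θ ^ ρ) % l  ≡⟨ ≡.cong (_% l) (log-θ^ ρ) ⟩
    ρ % N % l        ≡⟨ ≡.cong (_% l) (m<n⇒m%n≡m (ℕₚ.<-≤-trans ρ<l l≤N)) ⟩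
    ρ % l            ≡⟨ m<n⇒m%n≡m ρ<l ⟩
    ρ                ∎
    where open ≡.≡-Reasoning

  isCEDF⇔ : ∀ {λ′ S} → All (λ c → 1 ≤ c × c < m) S →
            IsCEDF m l λ′ S A A? ⇔ (∀ ρ → ρ < l → sum (map (λ c → count c ρ) S) ≡ λ′)
  isCEDF⇔ {λ′} {S} 1≤S<m = mk⇔
    (λ cedf ρ ρ<l → begin
      sum (map (λ c → count c ρ) S)                   ≡⟨ ≡.cong (λ r → sum (map (λ c → count c r) S)) (residue-θ^ ρ<l) ⟨
      sum (map (λ c → count c (residue (θ ^ ρ))) S)   ≡⟨ Δ-sums (θ^≉0 ρ) ⟨
      _                                               ≡⟨ IsCEDF.diffs cedf (θ ^ ρ) (θ^≉0 ρ) ⟩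
      λ′                                              ∎)
    (λ counts → record
      { disjoint = A-disjoint
      ; sizes    = λ _ → card-A
      ; diffs    = λ g g≉0 → ≡.trans (Δ-sums g≉0) (counts (residue g) (residue<l g))
      })
    where
    open ≡.≡-Reasoning
    Δ-sums : ∀ {g} → g ≉ 0# →
      sum (map (λ c → sum (map (λ i → multΔ (A? (modℕ (i + c) m)) (A? i) g) (upTo m))) S)
        ≡ sum (map (λ c → count c (residue g)) S)
    Δ-sums g≉0 = ≡.cong sum (map-cong-local (All.map (λ (1≤c , c<m) → Difference.Δ-sum 1≤c c<m g≉0) 1≤S<m))

-- Extension of scalars

module Transfer {q Q : ℕ} (Fq : FiniteField q) (FQ : FiniteField Q)
  (ι : FiniteField.Carrier Fq → FiniteField.Carrier FQ)
  (ι-hom : RingMorphisms.IsRingHomomorphism (CommutativeRing.rawRing (FiniteField.cring Fq))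
                                            (CommutativeRing.rawRing (FiniteField.cring FQ)) ι)
  (θ : FiniteField.Carrier Fq) (θ~ : FiniteField.Carrier FQ)
  (θ-primitive : FF.Primitive Fq θ) (θ~-primitive : FF.Primitive FQ θ~)
  (m M l e : ℕ) .{{_ : NonZero l}}
  (q-1≡ml² : q ∸ 1 ≡ m * (l * l)) (Q-1≡Ml² : Q ∸ 1 ≡ M * (l * l)) (2≤m : 2 ≤ m) (2≤M : 2 ≤ M)
  (M≡em : M ≡ e * m) (ιθ≈θ~^e : FiniteField._≈_ FQ (ι θ) (FF._^_ FQ θ~ e)) where

  module q = FiniteField Fq
  module Q = FiniteField FQ
  module Cq = Cosets Fq θ θ-primitive m l q-1≡ml² 2≤m
  module CQ = Cosets FQ θ~ θ~-primitive M l Q-1≡Ml² 2≤M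
  open RingMorphisms.IsRingHomomorphism ι-hom
  open FiniteFieldProperties FQ using (^-congˡ; ^-assocʳ)
  open FF Fq using () renaming (_^_ to _^q_)
  open FF FQ using () renaming (_^_ to _^Q_)

  ι-^ : ∀ x k → ι (x ^q k) Q.≈ ι x ^Q k
  ι-^ x zero    = 1#-homo
  ι-^ x (suc k) = Q.trans (*-homo x (x ^q k)) (Q.*-congˡ (ι-^ x k))

  ι-θ^ : ∀ k → ι (θ ^q k) Q.≈ θ~ ^Q (e * k)
  ι-θ^ k = Q.trans (ι-^ θ k) (Q.trans (^-congˡ k ιθ≈θ~^e) (^-assocʳ θ~ e k))

  ι-element-1 : ∀ c u → CQ.element (e * c) u Q.- Q.1# Q.≈ ι (Cq.element c u q.- q.1#)
  ι-element-1 c u = Q.sym (begin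
    ι (θ ^q (l * (c + u * m)) q.- q.1#)       ≈⟨ +-homo _ (q.- q.1#) ⟩
    ι (θ ^q (l * (c + u * m))) Q.+ ι (q.- q.1#) ≈⟨ Q.+-cong (ι-θ^ _) (Q.trans (-‿homo q.1#) (Q.-‿cong 1#-homo)) ⟩
    θ~ ^Q (e * (l * (c + u * m))) Q.- Q.1#    ≡⟨ ≡.cong (λ k → θ~ ^Q k Q.- Q.1#) exponent ⟩
    θ~ ^Q (l * (e * c + u * M)) Q.- Q.1#      ∎)
    where
    open SetoidReasoning Q.setoid
    exponent : e * (l * (c + u * m)) ≡ l * (e * c + u * M)
    exponent = ≡.trans (rearrange e l c u m) (≡.cong (λ M → l * (e * c + u * M)) (≡.sym M≡em))
      where
      rearrange : ∀ e l c u m → e * (l * (c + u * m)) ≡ l * (e * c + u * (e * m))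
      rearrange = solve-∀

  residue-ι : ∀ {y} → ¬ y q.≈ q.0# → CQ.residue (ι y) ≡ (e * Cq.residue y) % l
  residue-ι {y} y≉0 = begin
    CQ.log (ι y) % l              ≡⟨ ≡.cong (_% l) (CQ.log-unique (Q.trans (⟦⟧-cong (Cq.log-spec y≉0)) (ι-θ^ (Cq.log y)))) ⟩
    (e * Cq.log y) % CQ.N % l     ≡⟨ m∣n⇒o%n%m≡o%m l CQ.N _ CQ.l∣N ⟩
    (e * Cq.log y) % l            ≡⟨ %-*-cong l {e} ≡.refl (m%n%n≡m%n (Cq.log y) l) ⟨
    (e * Cq.residue y) % l        ∎
    where open ≡.≡-Reasoning

  count-transfer : ∀ {c ρ s} → 1 ≤ c → c < m → ρ < l → (e * s) % l ≡ 1 % l →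
                   CQ.count (e * c) ((e * ρ) % l) ≡ Cq.count c ρ
  count-transfer {c} {ρ} 1≤c c<m ρ<l es≡1 =
    ≡.cong length (filter-≐ solution~? solution? ((λ {u} → to {u}) , (λ {u} → from {u})) (upTo l))
    where
    y~ : ℕ → Q.Carrier
    y~ u = CQ.element (e * c) u Q.- Q.1#
    y : ℕ → q.Carrier
    y u = Cq.element c u q.- q.1#
    solution~? : Decidable (λ u → CQ.residue (y~ u) ≡ (e * ρ) % l)
    solution~? u = CQ.residue (y~ u) ℕ.≟ (e * ρ) % l
    solution? : Decidable (λ u → Cq.residue (y u) ≡ ρ)
    solution? u = Cq.residue (y u) ℕ.≟ ρ
    residue-y~ : ∀ u → CQ.residue (y~ u) ≡ (e * Cq.residue (y u)) % l
    residue-y~ u = ≡.trans (CQ.residue-cong (ι-element-1 c u)) (residue-ι (Cq.element-1≉0 1≤c c<m u))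
    to : ∀ {u} → CQ.residue (y~ u) ≡ (e * ρ) % l → Cq.residue (y u) ≡ ρ
    to {u} eq = ≡.trans (≡.sym (m<n⇒m%n≡m (Cq.residue<l _))) (≡.trans
      (%-*-cancelˡ l {e} _ ρ es≡1 (≡.trans (≡.sym (residue-y~ u)) eq)) (m<n⇒m%n≡m ρ<l))
    from : ∀ {u} → Cq.residue (y u) ≡ ρ → CQ.residue (y~ u) ≡ (e * ρ) % l
    from {u} eq = ≡.trans (residue-y~ u) (≡.cong (λ r → (e * r) % l) eq)

  counts⇔ : ∀ {S λ′ s} → All (λ c → 1 ≤ c × c < m) S → (e * s) % l ≡ 1 % l →
    (∀ ρ → ρ < l → sum (map (λ c → Cq.count c ρ) S) ≡ λ′) ⇔
    (∀ ρ → ρ < l → sum (map (λ c → CQ.count c ρ) (map (λ c → e * c) S)) ≡ λ′)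
  counts⇔ {S} {λ′} {s} 1≤S<m es≡1 = mk⇔
    (λ sums ρ′ ρ′<l → ≡.trans (sums-at (m%n<n (s * ρ′) l) (e*[s*ρ′]≡ρ′ ρ′<l)) (sums _ (m%n<n (s * ρ′) l)))
    (λ sums~ ρ ρ<l → ≡.trans (≡.sym (sums-at ρ<l ≡.refl)) (sums~ _ (m%n<n (e * ρ) l)))
    where
    sums-at : ∀ {ρ ρ′} → ρ < l → (e * ρ) % l ≡ ρ′ →
              sum (map (λ c → CQ.count c ρ′) (map (e *_) S)) ≡ sum (map (λ c → Cq.count c ρ) S)
    sums-at ρ<l ≡.refl = ≡.cong sum (≡.trans (≡.sym (map-∘ S))
      (map-cong-local (All.map (λ (1≤c , c<m) → count-transfer 1≤c c<m ρ<l es≡1) 1≤S<m)))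
    e*[s*ρ′]≡ρ′ : ∀ {ρ′} → ρ′ < l → (e * ((s * ρ′) % l)) % l ≡ ρ′
    e*[s*ρ′]≡ρ′ {ρ′} ρ′<l = begin
      (e * ((s * ρ′) % l)) % l   ≡⟨ %-*-cong l {e} ≡.refl (m%n%n≡m%n (s * ρ′) l) ⟩
      (e * (s * ρ′)) % l         ≡⟨ ≡.cong (_% l) (ℕₚ.*-assoc e s ρ′) ⟨
      (e * s * ρ′) % l           ≡⟨ %-*-cong l es≡1 ≡.refl ⟩
      (1 * ρ′) % l               ≡⟨ ≡.cong (_% l) (ℕₚ.*-identityˡ ρ′) ⟩
      ρ′ % l                     ≡⟨ m<n⇒m%n≡m ρ′<l ⟩
      ρ′                         ∎
      where open ≡.≡-Reasoning

-- Imported only here, since above _^_ is the field power of Defs.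
open import Data.Nat using (_^_)

theorem5 :
    (q m l t M e : ℕ) → IsPrimePower q → 2 ≤ m → 2 ≤ l → q ∸ 1 ≡ m * (l * l) →
    1 ≤ t → gcd l t ≡ 1 →
    (q ^ t) ∸ 1 ≡ M * (l * l) → M ≡ e * m →
    (Fq : FiniteField q) (FQ : FiniteField (q ^ t)) →
    (ι : FiniteField.Carrier Fq → FiniteField.Carrier FQ) →
    RingMorphisms.IsRingHomomorphism (CommutativeRing.rawRing (FiniteField.cring Fq)) (CommutativeRing.rawRing (FiniteField.cring FQ)) ι →
    (θ : FiniteField.Carrier Fq) (θ~ : FiniteField.Carrier FQ) →
    FF.Primitive Fq θ → FF.Primitive FQ θ~ →
    FiniteField._≈_ FQ (ι θ) (FF._^_ FQ θ~ e) →
    (S : List ℕ) → ¬ (S ≡ []) → Unique S → All (λ c → 1 ≤ c × c < m) S →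
    FF.IsCEDF Fq m l (length S) S
      (λ j → FF.InCoset Fq (FF._^_ Fq (FF._^_ Fq θ l) j) (FF._^_ Fq (FF._^_ Fq θ l) m))
      (λ j → FF.inCoset? Fq (FF._^_ Fq (FF._^_ Fq θ l) j) (FF._^_ Fq (FF._^_ Fq θ l) m))
    ⇔
    FF.IsCEDF FQ M l (length S) (map (λ c → e * c) S)
      (λ k → FF.InCoset FQ (FF._^_ FQ (FF._^_ FQ θ~ l) k) (FF._^_ FQ (FF._^_ FQ θ~ l) M))
      (λ k → FF.inCoset? FQ (FF._^_ FQ (FF._^_ FQ θ~ l) k) (FF._^_ FQ (FF._^_ FQ θ~ l) M))
theorem5 q m l t M e _ 2≤m 2≤l q-1≡ml² _ gcd≡1 Q-1≡Ml² M≡em Fq FQ ι ι-hom θ θ~ θ-primitive θ~-primitive ιθ≈θ~^e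
         S _ _ 1≤S<m =
  ⇔-sym (CQ.isCEDF⇔ 1≤eS<M) ⇔-∘ (counts⇔ 1≤S<m es≡1 ⇔-∘ Cq.isCEDF⇔ 1≤S<m)
  where
  -- The fields are given.
  instance
    l-nonZero : NonZero l
    l-nonZero = >-nonZero (ℕₚ.<-trans (s≤s z≤n) 2≤l)
  e-unit : Σ ℕ λ s → (e * s) % l ≡ 1 % l
  e-unit = extension-index-invertible {q} {m} {l} {t} {M} {e}
             (ℕₚ.<-trans (s≤s z≤n) 2≤m) q-1≡ml² gcd≡1 Q-1≡Ml² M≡em
  es≡1 : (e * proj₁ e-unit) % l ≡ 1 % l
  es≡1 = proj₂ e-unit
  1≤e : 1 ≤ e
  1≤e = unit⇒1≤ l 2≤l es≡1
  2≤M : 2 ≤ M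
  2≤M = ≡.subst (2 ≤_) (≡.sym M≡em) (ℕₚ.≤-trans 2≤m (ℕₚ.m≤n*m m e {{>-nonZero 1≤e}}))
  1≤eS<M : All (λ c → 1 ≤ c × c < M) (map (e *_) S)
  1≤eS<M = scaled-bounds 1≤e M≡em 1≤S<m
  open Transfer Fq FQ ι ι-hom θ θ~ θ-primitive θ~-primitive m M l e q-1≡ml² Q-1≡Ml² 2≤m 2≤M M≡em ιθ≈θ~^e
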